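{- Let $K$ be a number field, $A/K$ an abelian variety, $p$ a prime, $K_p = K \otimes_{\mathbb{Q}} \mathbb{Q}_p$, and $\Gamma \subset A(K)$ a subgroup, viewed inside $A(K_p)$. Fix a complete set of representatives $R \subset \Gamma$ for $\Gamma/p\Gamma$. Let $P \in A(K_p)$ and set $\mathcal{Q} = \{Q \in A(K_p) : \exists T \in R \colon pQ = P + T\}$. Define the equivalence relation $Q \sim Q' \iff Q - Q' \in \Gamma$ on $\mathcal{Q}$ and let $\mathcal{Q}'$ be a complete set of representatives for $\mathcal{Q}/{\sim}$. Then \[ q(P + \Gamma) = \bigl(\pi_p(P) + \pi_p(\Gamma)\bigr) \cup \bigcup_{Q \in \mathcal{Q}'} q(Q + \Gamma). \]
   Context: $\pi_p \colon A(K_p) \to A(K_p)/pA(K_p)$ is the quotient map. For $P \in A(K_p)$, $q(P) = \{\pi_p(Q) : Q \in A(K_p),\ \exists n \ge 0 \colon p^n Q = P\}$, and $q(S) = \bigcup_{P\in S} q(P)$ for subsets $S$. -}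

module Defs where

open import Level using (Level; _⊔_)
open import Algebra.Bundles using (AbelianGroup)
open import Data.Nat using (ℕ; zero; suc; _^_)
open import Data.Product using (Σ; _×_; _,_)
open import Data.Sum using (_⊎_)
open import Relation.Unary using (Pred)

-- The abelian group G plays the role of A(K_p); all subsets are predicates on it.
module _ {c ℓ : Level} (G : AbelianGroup c ℓ) where
  open AbelianGroup G

  infixr 8 _·_
  _·_ : ℕ → Carrier → Carrier
  zero  · x = ε
  suc n · x = x ∙ (n · x)

  record IsSubgroup {r : Level} (H : Pred Carrier r) : Set (c ⊔ ℓ ⊔ r) where
    field
      resp : ∀ {x y} → x ≈ y → H x → H y
      ε∈   : H ε
      ∙∈   : ∀ {x y} → H x → H y → H (x ∙ y)
      ⁻¹∈  : ∀ {x} → H x → H (x ⁻¹)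

  -- π_p x = π_p y  in  G / pG
  SameModp : ℕ → Carrier → Carrier → Set (c ⊔ ℓ)
  SameModp p x y = Σ Carrier λ z → x - y ≈ p · z

  SameModpIn : {r : Level} → ℕ → Pred Carrier r → Carrier → Carrier → Set (c ⊔ ℓ ⊔ r)
  SameModpIn p H x y = Σ Carrier λ z → H z × (x - y ≈ p · z)

  IsCompleteRepsModp : {r : Level} → ℕ → Pred Carrier r → Pred Carrier r → Set (c ⊔ ℓ ⊔ r)
  IsCompleteRepsModp p Γ R =
    (∀ T → R T → Γ T)
    × (∀ γ → Γ γ → Σ Carrier λ T → R T × SameModpIn p Γ γ T)
    × (∀ T T' → R T → R T' → SameModpIn p Γ T T' → T ≈ T')

  𝒬 : {r : Level} → ℕ → Pred Carrier r → Carrier → Pred Carrier (c ⊔ ℓ ⊔ r)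
  𝒬 p R P Q = Σ Carrier λ T → R T × (p · Q ≈ P ∙ T)

  IsCompleteRepsMod : {r s : Level} → Pred Carrier r → Pred Carrier s → Pred Carrier r → Set (c ⊔ ℓ ⊔ r ⊔ s)
  IsCompleteRepsMod Γ S S' =
    (∀ Q → S' Q → S Q)
    × (∀ Q → S Q → Σ Carrier λ Q' → S' Q' × Γ (Q - Q'))
    × (∀ Q₁ Q₂ → S' Q₁ → S' Q₂ → Γ (Q₁ - Q₂) → Q₁ ≈ Q₂)

  coset : {r : Level} → Carrier → Pred Carrier r → Pred Carrier (c ⊔ ℓ ⊔ r)
  coset P Γ y = Σ Carrier λ γ → Γ γ × (y ≈ P ∙ γ)

  -- π_p x ∈ q(S)  (a subset of G/pG is represented by its full preimage in G)
  InQ : {r : Level} → ℕ → Pred Carrier r → Pred Carrier (c ⊔ ℓ ⊔ r)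
  InQ p S x = Σ Carrier λ Q → Σ ℕ λ n → Σ Carrier λ P' →
                S P' × ((p ^ n) · Q ≈ P') × SameModp p x Q

  InPiCoset : {r : Level} → ℕ → Carrier → Pred Carrier r → Pred Carrier (c ⊔ ℓ ⊔ r)
  InPiCoset p P Γ x = Σ Carrier λ γ → Γ γ × SameModp p x (P ∙ γ)

  InUnionQ : {r : Level} → ℕ → Pred Carrier r → Pred Carrier r → Pred Carrier (c ⊔ ℓ ⊔ r)
  InUnionQ p Γ S' x = Σ Carrier λ Q → S' Q × InQ p (coset Q Γ) x

{-# OPTIONS --safe #-}
-- A point Q with pⁿQ ∈ P + Γ either has n = 0, and then π_p(Q) ∈ π_p(P) + π_p(Γ), or
-- y = pⁿ⁻¹Q is a p-division point of P + Γ.  Writing py = P + γ and γ = T + pz with T ∈ R,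
-- z ∈ Γ, the point y − z lies in 𝒬, so y ∈ Q + Γ for its representative Q ∈ 𝒬'.  Conversely
-- p(Q + Γ) ⊆ P + Γ for every Q ∈ 𝒬.  Hence q(P + Γ) = π_p(P + Γ) ∪ q(p⁻¹(P + Γ)) and
-- p⁻¹(P + Γ) = ⋃_{Q ∈ 𝒬'} (Q + Γ).
module Submission where

open import Defs hiding (_·_)
open import Level using (Level; _⊔_)
open import Algebra.Bundles using (AbelianGroup)
open import Data.Nat using (ℕ; zero; suc; _*_; _^_)
open import Data.Nat.Primality using (Prime)
open import Data.Sum using (_⊎_; inj₁; inj₂)
import Data.Sum as Sum
open import Data.Product using (Σ; _×_; _,_)
open import Function.Base using (_∘_)
open import Relation.Unary using (Pred; _⊆_)
open import Function.Bundles using (_⇔_; mk⇔; Equivalence)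

module _ {c ℓ : Level} (G : AbelianGroup c ℓ) where
  open AbelianGroup G
  open import Algebra.Properties.AbelianGroup G using (//-rightDividesˡ; ∙-cancelʳ)
  open import Algebra.Properties.CommutativeMonoid.Mult commutativeMonoid
    using (×-congʳ; ×-assocˡ; ×-distrib-+) renaming (_×_ to _×ₘ_)
  open import Relation.Binary.Reasoning.Setoid setoid

  infixr 8 _·_
  _·_ : ℕ → Carrier → Carrier
  _·_ = Defs._·_ G

  ·≈×ₘ : ∀ n x → n · x ≈ n ×ₘ x
  ·≈×ₘ zero    x = refl
  ·≈×ₘ (suc n) x = ∙-congˡ (·≈×ₘ n x)

  ·-congʳ : ∀ n {x y} → x ≈ y → n · x ≈ n · y
  ·-congʳ n {x} {y} x≈y = begin
    n · x   ≈⟨ ·≈×ₘ n x ⟩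
    n ×ₘ x  ≈⟨ ×-congʳ n x≈y ⟩
    n ×ₘ y  ≈⟨ ·≈×ₘ n y ⟨
    n · y   ∎

  ·-assoc : ∀ m n x → (m * n) · x ≈ m · (n · x)
  ·-assoc m n x = begin
    (m * n) · x      ≈⟨ ·≈×ₘ (m * n) x ⟩
    (m * n) ×ₘ x     ≈⟨ ×-assocˡ x m n ⟨
    m ×ₘ (n ×ₘ x)    ≈⟨ ×-congʳ m (·≈×ₘ n x) ⟨
    m ×ₘ (n · x)     ≈⟨ ·≈×ₘ m (n · x) ⟨
    m · (n · x)      ∎

  ·-distrib-∙ : ∀ n x y → n · (x ∙ y) ≈ n · x ∙ n · y
  ·-distrib-∙ n x y = begin
    n · (x ∙ y)        ≈⟨ ·≈×ₘ n (x ∙ y) ⟩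
    n ×ₘ (x ∙ y)       ≈⟨ ×-distrib-+ x y n ⟩
    n ×ₘ x ∙ n ×ₘ y    ≈⟨ ∙-cong (·≈×ₘ n x) (·≈×ₘ n y) ⟨
    n · x ∙ n · y      ∎

  ·∈ : ∀ {r} {H : Pred Carrier r} → IsSubgroup G H → ∀ n {x} → H x → H (n · x)
  ·∈ H-subgroup zero    Hx = IsSubgroup.ε∈ H-subgroup
  ·∈ H-subgroup (suc n) Hx = IsSubgroup.∙∈ H-subgroup Hx (·∈ H-subgroup n Hx)

  SameModp-respʳ : ∀ p {x y y'} → y ≈ y' → SameModp G p x y → SameModp G p x y'
  SameModp-respʳ p y≈y' (w , x-y≈pw) = w , trans (∙-congˡ (⁻¹-cong (sym y≈y'))) x-y≈pw

  module _ {r : Level} {Γ : Pred Carrier r} where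

    coset-intro : ∀ {Q y} → Γ (y - Q) → coset G Q Γ y
    coset-intro {Q} {y} Γ[y-Q] =
      y - Q , Γ[y-Q] , sym (trans (comm Q (y - Q)) (//-rightDividesˡ Q y))

    coset-shift : IsSubgroup G Γ → ∀ {Q y z} → Γ z → coset G Q Γ (y - z) → coset G Q Γ y
    coset-shift Γ-subgroup {Q} {y} {z} Γz (δ , Γδ , y-z≈Qδ) =
      δ ∙ z , IsSubgroup.∙∈ Γ-subgroup Γδ Γz , (begin
        y            ≈⟨ //-rightDividesˡ z y ⟨
        (y - z) ∙ z  ≈⟨ ∙-congʳ y-z≈Qδ ⟩
        Q ∙ δ ∙ z    ≈⟨ assoc Q δ z ⟩
        Q ∙ (δ ∙ z)  ∎)

  𝒬-shift : ∀ {r} {R : Pred Carrier r} p {P y γ T z} → R T →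
    p · y ≈ P ∙ γ → γ - T ≈ p · z → 𝒬 G p R P (y - z)
  𝒬-shift p {P} {y} {γ} {T} {z} RT py≈Pγ γ-T≈pz = T , RT , ∙-cancelʳ (p · z) _ _ (begin
    p · (y - z) ∙ p · z  ≈⟨ ·-distrib-∙ p (y - z) z ⟨
    p · ((y - z) ∙ z)    ≈⟨ ·-congʳ p (//-rightDividesˡ z y) ⟩
    p · y                ≈⟨ py≈Pγ ⟩
    P ∙ γ                ≈⟨ ∙-congˡ (//-rightDividesˡ T γ) ⟨
    P ∙ ((γ - T) ∙ T)    ≈⟨ ∙-congˡ (∙-congʳ γ-T≈pz) ⟩
    P ∙ (p · z ∙ T)      ≈⟨ ∙-congˡ (comm (p · z) T) ⟩
    P ∙ (T ∙ p · z)      ≈⟨ assoc P T (p · z) ⟨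
    P ∙ T ∙ p · z        ∎)

  -- The preimage is taken up to ≈, so that S need not respect ≈.
  infix 5 _·⁻¹_
  _·⁻¹_ : ∀ {r} → ℕ → Pred Carrier r → Pred Carrier (c ⊔ ℓ ⊔ r)
  (p ·⁻¹ S) y = Σ Carrier λ P' → S P' × (p · y ≈ P')

  InPi : ∀ {r} → ℕ → Pred Carrier r → Pred Carrier (c ⊔ ℓ ⊔ r)
  InPi p S x = Σ Carrier λ y → S y × SameModp G p x y

  InPi-coset : ∀ {r} {Γ : Pred Carrier r} p P x → InPi p (coset G P Γ) x ⇔ InPiCoset G p P Γ x
  InPi-coset p P x = mk⇔
    (λ { (y , (γ , Γγ , y≈Pγ) , x≡y) → γ , Γγ , SameModp-respʳ p y≈Pγ x≡y })
    (λ { (γ , Γγ , x≡Pγ) → P ∙ γ , (γ , Γγ , refl) , x≡Pγ })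

  InQ-unfold : ∀ {r} {S : Pred Carrier r} p x → InQ G p S x ⇔ (InPi p S x ⊎ InQ G p (p ·⁻¹ S) x)
  InQ-unfold p x = mk⇔ to from
    where
    to : InQ G p _ x → InPi p _ x ⊎ InQ G p (p ·⁻¹ _) x
    to (Q , zero , P' , SP' , 1Q≈P' , x≡Q) =
      inj₁ (P' , SP' , SameModp-respʳ p (trans (sym (identityʳ Q)) 1Q≈P') x≡Q)
    to (Q , suc m , P' , SP' , pQ≈P' , x≡Q) =
      inj₂ (Q , m , (p ^ m) · Q , (P' , SP' , trans (sym (·-assoc p (p ^ m) Q)) pQ≈P') , refl , x≡Q)

    from : InPi p _ x ⊎ InQ G p (p ·⁻¹ _) x → InQ G p _ x
    from (inj₁ (y , Sy , x≡y)) = y , 0 , y , Sy , identityʳ y , x≡y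
    from (inj₂ (Q , n , y , (P' , SP' , py≈P') , pⁿQ≈y , x≡Q)) =
      Q , suc n , P' , SP' , trans (·-assoc p (p ^ n) Q) (trans (·-congʳ p pⁿQ≈y) py≈P') , x≡Q

  InQ-mono : ∀ {r s} {S : Pred Carrier r} {T : Pred Carrier s} p → S ⊆ T → InQ G p S ⊆ InQ G p T
  InQ-mono p S⊆T (Q , n , P' , SP' , pⁿQ≈P' , x≡Q) = Q , n , P' , S⊆T SP' , pⁿQ≈P' , x≡Q

  InQ-cover : ∀ {r s t} {S : Pred Carrier r} {I : Pred Carrier s} {T : Carrier → Pred Carrier t} p →
    (∀ {y} → S y → Σ Carrier λ i → I i × T i y) →
    ∀ {x} → InQ G p S x → Σ Carrier λ i → I i × InQ G p (T i) x
  InQ-cover p cover (Q , n , P' , SP' , pⁿQ≈P' , x≡Q) with cover SP'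
  ... | i , Ii , TiP' = i , Ii , Q , n , P' , TiP' , pⁿQ≈P' , x≡Q

  module _ {r : Level} {Γ R Q' : Pred Carrier r} (Γ-subgroup : IsSubgroup G Γ) (p : ℕ) (P : Carrier) where

    ·⁻¹coset⊆⋃coset : (∀ γ → Γ γ → Σ Carrier λ T → R T × SameModpIn G p Γ γ T) →
      (∀ Q → 𝒬 G p R P Q → Σ Carrier λ Q'' → Q' Q'' × Γ (Q - Q'')) →
      ∀ {y} → (p ·⁻¹ coset G P Γ) y → Σ Carrier λ Q'' → Q' Q'' × coset G Q'' Γ y
    ·⁻¹coset⊆⋃coset reduce 𝒬-covered {y} (_ , (γ , Γγ , P'≈Pγ) , py≈P')
      with reduce γ Γγ
    ... | T , RT , z , Γz , γ-T≈pz
      with 𝒬-covered (y - z) (𝒬-shift p RT (trans py≈P' P'≈Pγ) γ-T≈pz)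
    ... | Q'' , Q'Q'' , Γ[y-z-Q''] = Q'' , Q'Q'' , coset-shift Γ-subgroup Γz (coset-intro Γ[y-z-Q''])

    coset⊆·⁻¹coset : (∀ T → R T → Γ T) → (∀ Q → Q' Q → 𝒬 G p R P Q) →
      ∀ {Q''} → Q' Q'' → coset G Q'' Γ ⊆ (p ·⁻¹ coset G P Γ)
    coset⊆·⁻¹coset R⊆Γ Q'⊆𝒬 {Q''} Q'Q'' {y} (δ , Γδ , y≈Q''δ) with Q'⊆𝒬 Q'' Q'Q''
    ... | T , RT , pQ''≈PT =
      p · y , (T ∙ p · δ , Γ[T∙pδ] , py≈P∙[T∙pδ]) , refl
      where
      Γ[T∙pδ] : Γ (T ∙ p · δ)
      Γ[T∙pδ] = IsSubgroup.∙∈ Γ-subgroup (R⊆Γ T RT) (·∈ Γ-subgroup p Γδ)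

      py≈P∙[T∙pδ] : p · y ≈ P ∙ (T ∙ p · δ)
      py≈P∙[T∙pδ] = begin
        p · y              ≈⟨ ·-congʳ p y≈Q''δ ⟩
        p · (Q'' ∙ δ)      ≈⟨ ·-distrib-∙ p Q'' δ ⟩
        p · Q'' ∙ p · δ    ≈⟨ ∙-congʳ pQ''≈PT ⟩
        P ∙ T ∙ p · δ      ≈⟨ assoc P T (p · δ) ⟩
        P ∙ (T ∙ p · δ)    ∎

lemma2p4 : ∀ {c ℓ r : Level} (G : AbelianGroup c ℓ) (p : ℕ) → Prime p →
    (Γ R : Pred (AbelianGroup.Carrier G) r) → IsSubgroup G Γ →
    IsCompleteRepsModp G p Γ R →
    (P : AbelianGroup.Carrier G) (Q' : Pred (AbelianGroup.Carrier G) r) →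
    IsCompleteRepsMod G Γ (𝒬 G p R P) Q' →
    ∀ x → InQ G p (coset G P Γ) x ⇔ (InPiCoset G p P Γ x ⊎ InUnionQ G p Γ Q' x)
lemma2p4 G p _ Γ R Γ-subgroup (R⊆Γ , reduce , _) P Q' (Q'⊆𝒬 , 𝒬-covered , _) x =
  mk⇔ (Sum.map (to (InPi-coset G p P x)) (InQ-cover G p (·⁻¹coset⊆⋃coset G Γ-subgroup p P reduce 𝒬-covered))
         ∘ to (InQ-unfold G p x))
      (from (InQ-unfold G p x)
         ∘ Sum.map (from (InPi-coset G p P x))
                   (λ { (Q'' , Q'Q'' , x∈q[Q''+Γ]) →
                        InQ-mono G p (coset⊆·⁻¹coset G Γ-subgroup p P R⊆Γ Q'⊆𝒬 Q'Q'') x∈q[Q''+Γ] }))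
  where open Equivalence
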